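{- Let $\mathbb{S}$ and $\mathbb{T}$ be algebraic theories such that: (S1) for all $\mathbb S$-terms $s',s''$: if $\emptyset \vdash s'$ and $\Gamma \vdash s' =_{\mathbb{S}} s''$ then $\emptyset \vdash s''$; (S2) for every $\mathbb S$-term $s'$ and variable $x$: if $\Gamma \vdash s' =_{\mathbb{S}} x$ then $\{x\} \vdash s'$; (S4) for every $\mathbb{S}$-term $s'$ with at least one variable there is a substitution $f$ from $\mathrm{var}(s')$ to $\mathbb{S}$-terms such that for every $x\in \mathrm{var}(s')$, $s'[f(y)/y\neq x] =_{\mathbb{S}} x$; (T2) for all $\mathbb T$-terms $t',t''$: if $\emptyset \vdash t'$ and $\Gamma \vdash t' =_{\mathbb{T}} t''$ then $\emptyset \vdash t''$; (T4) $\mathbb{T}$ has a constant $e_{\mathbb{T}}$. Suppose there are terms $2 \vdash_{\mathbb{S}} s$ and $2\vdash_{\mathbb{T}} t$ and constants $e_s$ of $\mathbb{S}$ and $e_t$ of $\mathbb{T}$ with $s(x,e_s) =_{\mathbb{S}} x =_{\mathbb{S}} s(e_s,x)$ and $t(x,e_t) =_{\mathbb{T}} x =_{\mathbb{T}} t(e_t,x)$. Let $\mathbb{U}$ be a composite theory of $\mathbb{T}$ after $\mathbb{S}$, and let $y_1,y_2,x_0$ be distinct variables. Then there are a $\mathbb{T}$-term $X \vdash t'$ and $\mathbb{S}$-terms $s'_x$ ($x\in X$) such that $s(t(y_1,y_2),x_0) =_{\mathbb{U}} t'[s'_x/x]$, for each $x \in \mathrm{var}(t')$ either $\mathrm{var}(s'_x)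 = \{y_1,x_0\}$ or $\mathrm{var}(s'_x) = \{y_2,x_0\}$, and there are $x$ with $\mathrm{var}(s'_x) = \{y_1,x_0\}$ and $x$ with $\mathrm{var}(s'_x)=\{y_2,x_0\}$. Similarly, there are a $\mathbb{T}$-term $X' \vdash t''$ and $\mathbb{S}$-terms $s''_{x'}$ ($x'\in X'$) such that $s(x_0,t(y_1,y_2)) =_{\mathbb{U}} t''[s''_{x'}/x']$, for each $x'\in\mathrm{var}(t'')$ either $\mathrm{var}(s''_{x'})=\{y_1,x_0\}$ or $\mathrm{var}(s''_{x'}) = \{y_2,x_0\}$, and both cases occur.
   Context: An algebraic theory consists of a signature and equations; $=_{\mathbb T}$ is provable equality. $\mathrm{var}(t)$ is the set of variables of $t$; $Y\vdash t$ means $\mathrm{var}(t)\subseteq Y$ ($\emptyset\vdash t$: $t$ has no variables); $\Gamma$ is an arbitrary context; a constant is a $0$-ary operation. $s'[f(y)/y\neq x]$ substitutes $f(y)$ for every variable $y\neq x$ of $s'$. For theories $\mathbb{S},\mathbb{T}$: $\mathbb{U}$ contains them if its signature contains both signatures and their equations are provable in $\mathbb{U}$; a separated term is $t[s_x/x]$ (simultaneous substitution) with $t$ a $\mathbb{T}$-term with variables in $X$ and $s_x$ $\mathbb{S}$-terms; separated terms $t[s_x/x]$, $t'[s'_{x'}/x']$ are equal modulo $(\mathbb{T},\mathbb{S})$ if there are $f:X\to Y$, $f':X'\to Y$ and $\mathbb{S}$-terms $\bar s_y$ with $t[f(x)/x]=_{\mathbb T}t'[f'(x')/x']$, $s_x=_{\mathbb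 S}\bar s_{f(x)}$, $s'_{x'}=_{\mathbb S}\bar s_{f'(x')}$; $\mathbb{U}$ is a composite theory of $\mathbb{T}$ after $\mathbb{S}$ if every $\mathbb U$-term is $\mathbb U$-equal to a separated term and any two separated terms $\mathbb U$-equal to a common term are equal modulo $(\mathbb{T},\mathbb{S})$. -}

module Defs where

open import Data.Nat using (ℕ; _≟_)
open import Data.Fin using (Fin; zero; suc)
open import Data.Product using (Σ; ∃; _×_; _,_)
open import Data.Sum using (_⊎_)
open import Data.Empty using (⊥)
open import Relation.Nullary using (¬_; yes; no)
open import Relation.Binary.PropositionalEquality using (_≡_; subst)

record Signature : Set₁ where
  field
    Op    : Set
    arity : Op → ℕ
open Signature public

data Term (Sg : Signature) (V : Set) : Set where
  var : V → Term Sg V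
  op  : (o : Op Sg) → (Fin (arity Sg o) → Term Sg V) → Term Sg V

_⟨_⟩ : ∀ {Sg V W} → Term Sg V → (V → Term Sg W) → Term Sg W
var x   ⟨ σ ⟩ = σ x
op o ts ⟨ σ ⟩ = op o (λ i → ts i ⟨ σ ⟩)

data _∈v_ {Sg : Signature} {V : Set} : V → Term Sg V → Set where
  here  : ∀ {x} → x ∈v var x
  there : ∀ {x o ts} (i : Fin (arity Sg o)) → x ∈v ts i → x ∈v op o ts

Ground : ∀ {Sg V} → Term Sg V → Set
Ground t = ∀ z → ¬ (z ∈v t)

VarsAre : ∀ {Sg V} → Term Sg V → V → V → Set
VarsAre t a b = ∀ z → (z ∈v t → (z ≡ a ⊎ z ≡ b)) × ((z ≡ a ⊎ z ≡ b) → z ∈v t)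

const : ∀ {Sg V} (c : Op Sg) → arity Sg c ≡ 0 → Term Sg V
const {Sg} c eq = op c (λ i → absurd (subst Fin eq i))
  where
  absurd : ∀ {A : Set} → Fin 0 → A
  absurd ()

-- binary substitution  u(a , b)  for a term u with variables in 2
pair : ∀ {A : Set} → A → A → Fin 2 → A
pair a b zero       = a
pair a b (suc zero) = b

record Theory : Set₁ where
  field
    sig : Signature
    Ax  : Set
    lhs : Ax → Term sig ℕ
    rhs : Ax → Term sig ℕ
open Theory public

data _⊢_≈_ (𝕋 : Theory) : Term (sig 𝕋) ℕ → Term (sig 𝕋) ℕ → Set where
  ≈refl  : ∀ {t} → 𝕋 ⊢ t ≈ t
  ≈sym   : ∀ {t u} → 𝕋 ⊢ t ≈ u → 𝕋 ⊢ u ≈ t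
  ≈trans : ∀ {t u v} → 𝕋 ⊢ t ≈ u → 𝕋 ⊢ u ≈ v → 𝕋 ⊢ t ≈ v
  ≈cong  : ∀ o {ts us} → (∀ i → 𝕋 ⊢ ts i ≈ us i) → 𝕋 ⊢ op o ts ≈ op o us
  ≈ax    : ∀ a (σ : ℕ → Term (sig 𝕋) ℕ) → 𝕋 ⊢ (lhs 𝕋 a ⟨ σ ⟩) ≈ (rhs 𝕋 a ⟨ σ ⟩)

record _⊆Sig_ (Sg Sg' : Signature) : Set where
  field
    map    : Op Sg → Op Sg'
    map-ar : ∀ o → arity Sg' (map o) ≡ arity Sg o
    map-inj : ∀ o o' → map o ≡ map o' → o ≡ o'
open _⊆Sig_ public

translate : ∀ {Sg Sg' V} → Sg ⊆Sig Sg' → Term Sg V → Term Sg' V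
translate ι (var x)   = var x
translate ι (op o ts) = op (map ι o) (λ i → translate ι (ts (subst Fin (map-ar ι o) i)))

record Contains (𝕌 𝕋 : Theory) : Set where
  field
    inc   : sig 𝕋 ⊆Sig sig 𝕌
    sound : ∀ a → 𝕌 ⊢ translate inc (lhs 𝕋 a) ≈ translate inc (rhs 𝕋 a)
open Contains public

sep : ∀ {𝕌 𝕋 𝕊} → Contains 𝕌 𝕋 → Contains 𝕌 𝕊 →
      Term (sig 𝕋) ℕ → (ℕ → Term (sig 𝕊) ℕ) → Term (sig 𝕌) ℕ
sep cT cS t s = translate (inc cT) t ⟨ (λ x → translate (inc cS) (s x)) ⟩

-- t[s_x/x] and t'[s'_x'/x'] are equal modulo (𝕋,𝕊)
-- (X, X' are taken to be var(t), var(t'); Y ⊆ ℕ)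
EqMod : (𝕋 𝕊 : Theory) →
        Term (sig 𝕋) ℕ → (ℕ → Term (sig 𝕊) ℕ) →
        Term (sig 𝕋) ℕ → (ℕ → Term (sig 𝕊) ℕ) → Set
EqMod 𝕋 𝕊 t s t' s' =
  Σ (ℕ → ℕ) λ f → Σ (ℕ → ℕ) λ f' → Σ (ℕ → Term (sig 𝕊) ℕ) λ sbar →
    (𝕋 ⊢ (t ⟨ (λ x → var (f x)) ⟩) ≈ (t' ⟨ (λ x → var (f' x)) ⟩))
    × (∀ x → x ∈v t → 𝕊 ⊢ s x ≈ sbar (f x))
    × (∀ x → x ∈v t' → 𝕊 ⊢ s' x ≈ sbar (f' x))

record IsComposite (𝕌 𝕋 𝕊 : Theory) (cT : Contains 𝕌 𝕋) (cS : Contains 𝕌 𝕊) : Set where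
  field
    separation : ∀ (u : Term (sig 𝕌) ℕ) →
      Σ (Term (sig 𝕋) ℕ) λ t → Σ (ℕ → Term (sig 𝕊) ℕ) λ s → 𝕌 ⊢ u ≈ sep cT cS t s
    uniqueness : ∀ t s t' s' (u : Term (sig 𝕌) ℕ) →
      𝕌 ⊢ sep cT cS t s ≈ u → 𝕌 ⊢ sep cT cS t' s' ≈ u → EqMod 𝕋 𝕊 t s t' s'

PreservesGround : Theory → Set
PreservesGround 𝕋 = ∀ (u v : Term (sig 𝕋) ℕ) → Ground u → 𝕋 ⊢ u ≈ v → Ground v

VarCondition : Theory → Set
VarCondition 𝕊 = ∀ (s' : Term (sig 𝕊) ℕ) x → 𝕊 ⊢ s' ≈ var x → ∀ z → z ∈v s' → z ≡ x

except : ∀ {Sg} → (ℕ → Term Sg ℕ) → ℕ → ℕ → Term Sg ℕ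
except f x y with y ≟ x
... | yes _ = var y
... | no  _ = f y

S4 : Theory → Set
S4 𝕊 = ∀ (s' : Term (sig 𝕊) ℕ) → (∃ λ x → x ∈v s') →
  Σ (ℕ → Term (sig 𝕊) ℕ) λ f → ∀ x → x ∈v s' → 𝕊 ⊢ (s' ⟨ except f x ⟩) ≈ var x

HasConstant : Theory → Set
HasConstant 𝕋 = Σ (Op (sig 𝕋)) λ c → arity (sig 𝕋) c ≡ 0

module Submission where

-- Separate u = s(t(y₁,y₂), x₀) as T[S_x/x]. Substituting the unit of s for x₀ turns u into the
-- separated term t(y₁,y₂), so by uniqueness of separated forms each component S_x becomes y₁ or
-- y₂, and both occur. Substituting the unit of t for y₂ collapses u to the 𝕊-term s(y₁,x₀); a
-- component without y₂ is untouched by this, and re-separating the other components exhibits a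
-- separated form of s(y₁,x₀), so uniqueness forces S_x = s(y₁,x₀). Variable sets are invariant
-- under provable equality since both theories preserve groundness and have constants. The second
-- half is the first one applied to s with its arguments swapped.

open import Defs
open import Data.Nat using (ℕ; zero; suc; _+_; _≟_)
open import Data.Nat.Properties using (+-suc; +-identityʳ)
open import Data.Fin using (Fin; zero; suc)
open import Data.Fin.Properties using (any?)
open import Data.Product using (Σ; ∃; _×_; _,_; proj₁; proj₂; uncurry)
open import Data.Sum using (_⊎_; inj₁; inj₂)
open import Data.Empty using (⊥-elim)
open import Relation.Nullary using (¬_; Dec; yes; no)
open import Relation.Nullary.Decidable using (map′)
open import Relation.Binary.Bundles using (Setoid)
open import Relation.Binary.PropositionalEquality using (_≡_; refl; sym; trans; cong; subst)
import Relation.Binary.Reasoning.Setoid as SetoidReasoning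

triangle : ℕ → ℕ
triangle zero    = zero
triangle (suc d) = suc (triangle d + d)

cantor : ℕ → ℕ → ℕ
cantor a b = triangle (a + b) + a

uncantor : ℕ → ℕ × ℕ
uncantor zero    = 0 , 0
uncantor (suc n) = next (uncantor n)
  where
  next : ℕ × ℕ → ℕ × ℕ
  next (a , zero)  = 0 , suc a
  next (a , suc b) = suc a , b

uncantor-diagonal : ∀ d a b → a + b ≡ d → uncantor (triangle d + a) ≡ (a , b)
uncantor-diagonal zero    zero zero          refl = refl
uncantor-diagonal zero    zero (suc b)       ()
uncantor-diagonal (suc d) zero .(suc d)      refl
  rewrite +-identityʳ (triangle d + d) | uncantor-diagonal d d 0 (+-identityʳ d) = refl
uncantor-diagonal d       (suc a) b          eq
  rewrite +-suc (triangle d) a | uncantor-diagonal d a (suc b) (trans (+-suc a b) eq) = refl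

uncantor-cantor : ∀ a b → uncantor (cantor a b) ≡ (a , b)
uncantor-cantor a b = uncantor-diagonal (a + b) a b refl

module _ {Sg : Signature} where

  ∈v-⟨⟩⁺ : ∀ {A B : Set} (a : Term Sg A) {σ : A → Term Sg B} {v z} →
           v ∈v a → z ∈v σ v → z ∈v (a ⟨ σ ⟩)
  ∈v-⟨⟩⁺ (var x)   here        z∈ = z∈
  ∈v-⟨⟩⁺ (op o ts) (there i p) z∈ = there i (∈v-⟨⟩⁺ (ts i) p z∈)

  ∈v-⟨⟩⁻ : ∀ {A B : Set} (a : Term Sg A) {σ : A → Term Sg B} {z} →
           z ∈v (a ⟨ σ ⟩) → ∃ λ v → v ∈v a × z ∈v σ v
  ∈v-⟨⟩⁻ (var x)   z∈          = x , here , z∈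
  ∈v-⟨⟩⁻ (op o ts) (there i p) with ∈v-⟨⟩⁻ (ts i) p
  ... | v , v∈ , z∈ = v , there i v∈ , z∈

  ∈v-var : ∀ {A : Set} {z x : A} → z ∈v var {Sg} x → z ≡ x
  ∈v-var here = refl

  _∈v?_ : (z : ℕ) (a : Term Sg ℕ) → Dec (z ∈v a)
  z ∈v? var x   = map′ (λ { refl → here }) ∈v-var (z ≟ x)
  z ∈v? op o ts = map′ (λ (i , p) → there i p) (λ { (there i p) → i , p })
                       (any? λ i → z ∈v? ts i)

  const-ground : ∀ {V} c (c0 : arity Sg c ≡ 0) → Ground {Sg} {V} (const c c0)
  const-ground c c0 z (there i _) with subst Fin c0 i
  ... | ()

∈v-translate : ∀ {Sg Sg' V} (ι : Sg ⊆Sig Sg') (a : Term Sg V) {z} → z ∈v translate ι a → z ∈v a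
∈v-translate ι (var x)   here        = here
∈v-translate ι (op o ts) (there i p) = there _ (∈v-translate ι (ts _) p)

pair-rel : ∀ {A B : Set} (R : A → B → Set) {a a' b b'} → R a b → R a' b' →
           ∀ i → R (pair a a' i) (pair b b' i)
pair-rel R r r' zero       = r
pair-rel R r r' (suc zero) = r'

_↦_ : ∀ {Sg} → ℕ → Term Sg ℕ → ℕ → Term Sg ℕ
(z ↦ E) v with v ≟ z
... | yes _ = E
... | no  _ = var v

↦-self : ∀ {Sg} z (E : Term Sg ℕ) → (z ↦ E) z ≡ E
↦-self z E with z ≟ z
... | yes _  = refl
... | no z≢z = ⊥-elim (z≢z refl)

FixesAllBut : ∀ {Sg} → (ℕ → Term Sg ℕ) → ℕ → Set
FixesAllBut ρ z = ∀ v → ¬ v ≡ z → ρ v ≡ var v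

↦-fixesAllBut : ∀ {Sg} z (E : Term Sg ℕ) → FixesAllBut (z ↦ E) z
↦-fixesAllBut z E v v≢z with v ≟ z
... | yes v≡z = ⊥-elim (v≢z v≡z)
... | no  _   = refl

≈-setoid : Theory → Setoid _ _
≈-setoid K = record
  { Carrier       = Term (sig K) ℕ
  ; _≈_           = λ a b → K ⊢ a ≈ b
  ; isEquivalence = record { refl = ≈refl ; sym = ≈sym ; trans = ≈trans }
  }

module ≈-Reasoning (K : Theory) = SetoidReasoning (≈-setoid K)

module _ {K : Theory} where

  ≡⇒≈ : ∀ {a b} → a ≡ b → K ⊢ a ≈ b
  ≡⇒≈ refl = ≈refl

  ⟨⟩-assoc : ∀ {A B : Set} (a : Term (sig K) A) (τ : A → Term (sig K) B) (σ : B → Term (sig K) ℕ) →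
             K ⊢ ((a ⟨ τ ⟩) ⟨ σ ⟩) ≈ (a ⟨ (λ v → τ v ⟨ σ ⟩) ⟩)
  ⟨⟩-assoc (var x)   τ σ = ≈refl
  ⟨⟩-assoc (op o ts) τ σ = ≈cong o λ i → ⟨⟩-assoc (ts i) τ σ

  ⟨⟩-congʳ : ∀ {A : Set} (a : Term (sig K) A) {σ σ' : A → Term (sig K) ℕ} →
             (∀ v → v ∈v a → K ⊢ σ v ≈ σ' v) → K ⊢ (a ⟨ σ ⟩) ≈ (a ⟨ σ' ⟩)
  ⟨⟩-congʳ (var x)   h = h x here
  ⟨⟩-congʳ (op o ts) h = ≈cong o λ i → ⟨⟩-congʳ (ts i) λ v p → h v (there i p)

  ⟨var⟩ : (a : Term (sig K) ℕ) → K ⊢ (a ⟨ var ⟩) ≈ a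
  ⟨var⟩ (var x)   = ≈refl
  ⟨var⟩ (op o ts) = ≈cong o λ i → ⟨var⟩ (ts i)

  ⟨⟩-fix : (a : Term (sig K) ℕ) {σ : ℕ → Term (sig K) ℕ} → (∀ v → v ∈v a → σ v ≡ var v) →
           K ⊢ (a ⟨ σ ⟩) ≈ a
  ⟨⟩-fix a h = ≈trans (⟨⟩-congʳ a λ v v∈ → ≡⇒≈ (h v v∈)) (⟨var⟩ a)

  ⟨⟩-ground : {a : Term (sig K) ℕ} {σ : ℕ → Term (sig K) ℕ} → Ground a → K ⊢ (a ⟨ σ ⟩) ≈ a
  ⟨⟩-ground {a} g = ⟨⟩-fix a λ v v∈ → ⊥-elim (g v v∈)

  ⟨⟩-congˡ : ∀ {a b} (σ : ℕ → Term (sig K) ℕ) → K ⊢ a ≈ b → K ⊢ (a ⟨ σ ⟩) ≈ (b ⟨ σ ⟩)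
  ⟨⟩-congˡ σ ≈refl          = ≈refl
  ⟨⟩-congˡ σ (≈sym p)       = ≈sym (⟨⟩-congˡ σ p)
  ⟨⟩-congˡ σ (≈trans p q)   = ≈trans (⟨⟩-congˡ σ p) (⟨⟩-congˡ σ q)
  ⟨⟩-congˡ σ (≈cong o ps)   = ≈cong o λ i → ⟨⟩-congˡ σ (ps i)
  ⟨⟩-congˡ σ (≈ax a τ)      =
    ≈trans (⟨⟩-assoc (lhs K a) τ σ) (≈trans (≈ax a _) (≈sym (⟨⟩-assoc (rhs K a) τ σ)))

  ⟨pair⟩-cong : (b : Term (sig K) (Fin 2)) {A A' B B' : Term (sig K) ℕ} →
                K ⊢ A ≈ A' → K ⊢ B ≈ B' → K ⊢ (b ⟨ pair A B ⟩) ≈ (b ⟨ pair A' B' ⟩)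
  ⟨pair⟩-cong b p q = ⟨⟩-congʳ b λ i _ → pair-rel (λ X Y → K ⊢ X ≈ Y) p q i

  ⟨pair⟩-⟨⟩ : (b : Term (sig K) (Fin 2)) {A B : Term (sig K) ℕ} (θ : ℕ → Term (sig K) ℕ) →
              K ⊢ ((b ⟨ pair A B ⟩) ⟨ θ ⟩) ≈ (b ⟨ pair (A ⟨ θ ⟩) (B ⟨ θ ⟩) ⟩)
  ⟨pair⟩-⟨⟩ b θ =
    ≈trans (⟨⟩-assoc b _ θ) (⟨⟩-congʳ b λ i _ → pair-rel (λ X Y → K ⊢ (X ⟨ θ ⟩) ≈ Y) ≈refl ≈refl i)

flip : ∀ {Sg} → Term Sg (Fin 2) → Term Sg (Fin 2)
flip b = b ⟨ pair (var (suc zero)) (var zero) ⟩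

flip-⟨pair⟩ : ∀ {K : Theory} (b : Term (sig K) (Fin 2)) {A B : Term (sig K) ℕ} →
              K ⊢ (flip b ⟨ pair A B ⟩) ≈ (b ⟨ pair B A ⟩)
flip-⟨pair⟩ b = ≈trans (⟨⟩-assoc b _ _) (⟨⟩-congʳ b λ { zero _ → ≈refl ; (suc zero) _ → ≈refl })

module _ {K U : Theory} (c : Contains U K) where

  translate-⟨⟩ : ∀ {A : Set} (a : Term (sig K) A) (σ : A → Term (sig K) ℕ) →
                 U ⊢ translate (inc c) (a ⟨ σ ⟩) ≈ (translate (inc c) a ⟨ (λ v → translate (inc c) (σ v)) ⟩)
  translate-⟨⟩ (var x)   σ = ≈refl
  translate-⟨⟩ (op o ts) σ = ≈cong _ λ i → translate-⟨⟩ (ts _) σ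

  translate-≈ : ∀ {a b} → K ⊢ a ≈ b → U ⊢ translate (inc c) a ≈ translate (inc c) b
  translate-≈ ≈refl          = ≈refl
  translate-≈ (≈sym p)       = ≈sym (translate-≈ p)
  translate-≈ (≈trans p q)   = ≈trans (translate-≈ p) (translate-≈ q)
  translate-≈ (≈cong o ps)   = ≈cong _ λ i → translate-≈ (ps _)
  translate-≈ (≈ax a σ)      =
    ≈trans (translate-⟨⟩ (lhs K a) σ)
      (≈trans (⟨⟩-congˡ _ (sound c a)) (≈sym (translate-⟨⟩ (rhs K a) σ)))

  translate-⟨pair⟩ : (b : Term (sig K) (Fin 2)) {A B : Term (sig K) ℕ} →
                     U ⊢ translate (inc c) (b ⟨ pair A B ⟩)
                       ≈ (translate (inc c) b ⟨ pair (translate (inc c) A) (translate (inc c) B) ⟩)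
  translate-⟨pair⟩ b =
    ≈trans (translate-⟨⟩ b _)
      (⟨⟩-congʳ (translate (inc c) b) λ i _ →
        pair-rel (λ X Y → U ⊢ translate (inc c) X ≈ Y) ≈refl ≈refl i)

  translate-⟨⟩-⟨⟩ : ∀ {A B : Set} (a : Term (sig K) A) (τ : A → Term (sig K) B) (θ : B → Term (sig U) ℕ) →
                    U ⊢ (translate (inc c) (a ⟨ τ ⟩) ⟨ θ ⟩)
                      ≈ (translate (inc c) a ⟨ (λ v → translate (inc c) (τ v) ⟨ θ ⟩) ⟩)
  translate-⟨⟩-⟨⟩ (var x)   τ θ = ≈refl
  translate-⟨⟩-⟨⟩ (op o ts) τ θ = ≈cong _ λ i → translate-⟨⟩-⟨⟩ (ts _) τ θ

  translate-flip-⟨pair⟩ : (b : Term (sig K) (Fin 2)) {A B : Term (sig U) ℕ} →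
                          U ⊢ (translate (inc c) (flip b) ⟨ pair A B ⟩) ≈ (translate (inc c) b ⟨ pair B A ⟩)
  translate-flip-⟨pair⟩ b =
    ≈trans (translate-⟨⟩-⟨⟩ b _ _)
           (⟨⟩-congʳ (translate (inc c) b) λ { zero _ → ≈refl ; (suc zero) _ → ≈refl })

module _ {K : Theory} (pg : PreservesGround K) (hc : HasConstant K) where

  -- Replacing every variable other than z by a constant: if z were lost along a ≈ b,
  -- a ground term would be provably equal to one containing z.
  ∈v-≈ : ∀ {a b z} → K ⊢ a ≈ b → z ∈v a → z ∈v b
  ∈v-≈ {a} {b} {z} a≈b z∈a with z ∈v? b
  ... | yes z∈b = z∈b
  ... | no  z∉b = ⊥-elim (pg (b ⟨ κ ⟩) (a ⟨ κ ⟩) bκ-ground (≈sym (⟨⟩-congˡ κ a≈b)) z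
                            (∈v-⟨⟩⁺ a z∈a z∈κz))
    where
    κ : ℕ → Term (sig K) ℕ
    κ = except (λ _ → const (proj₁ hc) (proj₂ hc)) z
    z∈κz : z ∈v κ z
    z∈κz with z ≟ z
    ... | yes _  = here
    ... | no z≢z = ⊥-elim (z≢z refl)
    bκ-ground : Ground (b ⟨ κ ⟩)
    bκ-ground w w∈ with ∈v-⟨⟩⁻ b w∈
    ... | v , v∈b , w∈κv with v ≟ z
    ...   | yes refl = z∉b v∈b
    ...   | no  _    = const-ground (proj₁ hc) (proj₂ hc) w w∈κv

  VarsAre-≈ : ∀ {a b y x} → K ⊢ a ≈ b → VarsAre b y x → VarsAre a y x
  VarsAre-≈ a≈b h z =
    (λ z∈a → proj₁ (h z) (∈v-≈ a≈b z∈a)) , (λ e → ∈v-≈ (≈sym a≈b) (proj₂ (h z) e))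

module Unital {K : Theory} (pg : PreservesGround K) (e : Op (sig K)) (e0 : arity (sig K) e ≡ 0)
  (b : Term (sig K) (Fin 2))
  (identityʳ : ∀ x → K ⊢ (b ⟨ pair (var x) (const e e0) ⟩) ≈ var x)
  (identityˡ : ∀ x → K ⊢ (b ⟨ pair (const e e0) (var x) ⟩) ≈ var x) where

  private
    ∈v-≈′ : ∀ {a a' z} → K ⊢ a ≈ a' → z ∈v a → z ∈v a'
    ∈v-≈′ = ∈v-≈ pg (e , e0)

  zero∈v : zero ∈v b
  zero∈v with ∈v-⟨⟩⁻ b (∈v-≈′ (≈sym (identityʳ 0)) here)
  ... | zero     , 0∈b , _   = 0∈b
  ... | suc zero , _   , 0∈e = ⊥-elim (const-ground e e0 0 0∈e)

  one∈v : suc zero ∈v b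
  one∈v with ∈v-⟨⟩⁻ b (∈v-≈′ (≈sym (identityˡ 0)) here)
  ... | zero     , _   , 0∈e = ⊥-elim (const-ground e e0 0 0∈e)
  ... | suc zero , 1∈b , _   = 1∈b

  VarsAre-⟨pair⟩ : ∀ (a a' : ℕ) → VarsAre (b ⟨ pair (var a) (var a') ⟩) a a'
  VarsAre-⟨pair⟩ a a' z = occurs , λ { (inj₁ refl) → ∈v-⟨⟩⁺ b zero∈v here
                                     ; (inj₂ refl) → ∈v-⟨⟩⁺ b one∈v here }
    where
    occurs : z ∈v (b ⟨ pair (var a) (var a') ⟩) → z ≡ a ⊎ z ≡ a'
    occurs z∈ with ∈v-⟨⟩⁻ b z∈
    ... | zero     , _ , here = inj₁ refl
    ... | suc zero , _ , here = inj₂ refl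

  module _ {U : Theory} (c : Contains U K) where

    private
      tr : ∀ {V} → Term (sig K) V → Term (sig U) V
      tr = translate (inc c)

      E : Term (sig K) ℕ
      E = const e e0

      trE-ground : Ground (tr E)
      trE-ground z z∈ = const-ground e e0 z (∈v-translate (inc c) E z∈)

      translate-instance : ∀ {X Y} A → K ⊢ (b ⟨ pair X Y ⟩) ≈ var 0 →
        U ⊢ (tr b ⟨ pair (tr X ⟨ (λ _ → A) ⟩) (tr Y ⟨ (λ _ → A) ⟩) ⟩) ≈ A
      translate-instance {X} {Y} A law = begin
        tr b ⟨ pair (tr X ⟨ κ ⟩) (tr Y ⟨ κ ⟩) ⟩   ≈⟨ ⟨pair⟩-⟨⟩ (tr b) κ ⟨
        (tr b ⟨ pair (tr X) (tr Y) ⟩) ⟨ κ ⟩        ≈⟨ ⟨⟩-congˡ κ (translate-⟨pair⟩ c b) ⟨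
        tr (b ⟨ pair X Y ⟩) ⟨ κ ⟩                  ≈⟨ ⟨⟩-congˡ κ (translate-≈ c law) ⟩
        A                                          ∎
        where
        open ≈-Reasoning U
        κ : ℕ → Term (sig U) ℕ
        κ _ = A

    translate-identityʳ : ∀ A → U ⊢ (tr b ⟨ pair A (tr E) ⟩) ≈ A
    translate-identityʳ A =
      ≈trans (⟨pair⟩-cong (tr b) ≈refl (≈sym (⟨⟩-ground {a = tr E} trE-ground)))
             (translate-instance {var 0} {E} A (identityʳ 0))

    translate-identityˡ : ∀ A → U ⊢ (tr b ⟨ pair (tr E) A ⟩) ≈ A
    translate-identityˡ A =
      ≈trans (⟨pair⟩-cong (tr b) (≈sym (⟨⟩-ground {a = tr E} trE-ground)) ≈refl)
             (translate-instance {E} {var 0} A (identityˡ 0))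

ComponentsSplit : ∀ {SgT SgS} → Term SgT ℕ → (ℕ → Term SgS ℕ) → ℕ → ℕ → ℕ → Set
ComponentsSplit T S y₁ y₂ x₀ =
  (∀ x → x ∈v T → VarsAre (S x) y₁ x₀ ⊎ VarsAre (S x) y₂ x₀)
  × (∃ λ x → x ∈v T × VarsAre (S x) y₁ x₀)
  × (∃ λ x → x ∈v T × VarsAre (S x) y₂ x₀)

module Composite {𝕌 𝕋 𝕊 : Theory} {cT : Contains 𝕌 𝕋} {cS : Contains 𝕌 𝕊}
  (composite : IsComposite 𝕌 𝕋 𝕊 cT cS) (pgT : PreservesGround 𝕋) (hcT : HasConstant 𝕋) where

  open IsComposite composite

  private
    trT : ∀ {V} → Term (sig 𝕋) V → Term (sig 𝕌) V
    trT = translate (inc cT)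

    trS : ∀ {V} → Term (sig 𝕊) V → Term (sig 𝕌) V
    trS = translate (inc cS)

  sep-⟨⟩ : ∀ T S (σ : ℕ → Term (sig 𝕊) ℕ) →
           𝕌 ⊢ (sep cT cS T S ⟨ (λ v → trS (σ v)) ⟩) ≈ sep cT cS T (λ x → S x ⟨ σ ⟩)
  sep-⟨⟩ T S σ =
    ≈trans (⟨⟩-assoc (trT T) _ _) (⟨⟩-congʳ (trT T) λ x _ → ≈sym (translate-⟨⟩ cS (S x) σ))

  components-match : ∀ {T S T' S'} → 𝕌 ⊢ sep cT cS T S ≈ sep cT cS T' S' →
                     ∀ {x} → x ∈v T → ∃ λ x' → x' ∈v T' × 𝕊 ⊢ S x ≈ S' x'
  components-match {T} {S} {T'} {S'} eq {x} x∈T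
    with uniqueness T S T' S' _ eq ≈refl
  ... | f , f' , s̄ , Tf≈T'f' , S≈s̄f , S'≈s̄f'
    with ∈v-⟨⟩⁻ T' (∈v-≈ pgT hcT Tf≈T'f' (∈v-⟨⟩⁺ T x∈T here))
  ... | x' , x'∈T' , fx∈f'x' =
    x' , x'∈T' ,
    ≈trans (S≈s̄f x x∈T) (≈trans (≡⇒≈ (cong s̄ (∈v-var fx∈f'x'))) (≈sym (S'≈s̄f' x' x'∈T')))

  -- cantor renames the variables of the τ x apart, so one function indexes all their 𝕊-components.
  sep-merge : ∀ T (τ : ℕ → Term (sig 𝕋) ℕ) (σ : ℕ → ℕ → Term (sig 𝕊) ℕ) →
    𝕌 ⊢ sep cT cS (T ⟨ (λ x → τ x ⟨ (λ w → var (cantor x w)) ⟩) ⟩) (λ n → uncurry σ (uncantor n))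
      ≈ (trT T ⟨ (λ x → sep cT cS (τ x) (σ x)) ⟩)
  sep-merge T τ σ = begin
    trT (T ⟨ κ ⟩) ⟨ θ ⟩                            ≈⟨ ⟨⟩-congˡ θ (translate-⟨⟩ cT T κ) ⟩
    (trT T ⟨ (λ x → trT (κ x)) ⟩) ⟨ θ ⟩            ≈⟨ ⟨⟩-assoc (trT T) _ θ ⟩
    trT T ⟨ (λ x → trT (κ x) ⟨ θ ⟩) ⟩              ≈⟨ ⟨⟩-congʳ (trT T) (λ x _ → renamed x) ⟩
    trT T ⟨ (λ x → sep cT cS (τ x) (σ x)) ⟩        ∎
    where
    open ≈-Reasoning 𝕌
    κ : ℕ → Term (sig 𝕋) ℕ
    κ x = τ x ⟨ (λ w → var (cantor x w)) ⟩
    θ : ℕ → Term (sig 𝕌) ℕ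
    θ n = trS (uncurry σ (uncantor n))
    renamed : ∀ x → 𝕌 ⊢ (trT (κ x) ⟨ θ ⟩) ≈ sep cT cS (τ x) (σ x)
    renamed x = begin
      trT (κ x) ⟨ θ ⟩                                      ≈⟨ ⟨⟩-congˡ θ (translate-⟨⟩ cT (τ x) _) ⟩
      (trT (τ x) ⟨ (λ w → var (cantor x w)) ⟩) ⟨ θ ⟩       ≈⟨ ⟨⟩-assoc (trT (τ x)) _ θ ⟩
      trT (τ x) ⟨ (λ w → θ (cantor x w)) ⟩                 ≈⟨ ⟨⟩-congʳ (trT (τ x)) (λ w _ → ≡⇒≈ (θ-cantor w)) ⟩
      sep cT cS (τ x) (σ x)                                ∎
      where
      θ-cantor : ∀ w → θ (cantor x w) ≡ trS (σ x w)
      θ-cantor w = cong (λ p → trS (uncurry σ p)) (uncantor-cantor x w)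

  -- Re-separating every component of u ⟨ ρ ⟩ and merging gives a separated form of r; by uniqueness
  -- its components, in particular those re-separating the untouched S x, are all equal to r.
  fixed-component-≈ : ∀ {u T S} → 𝕌 ⊢ u ≈ sep cT cS T S →
    ∀ {ρ r} → 𝕌 ⊢ (u ⟨ ρ ⟩) ≈ trS r →
    ∀ {x} → x ∈v T → (∀ v → v ∈v S x → ρ v ≡ var v) → 𝕊 ⊢ S x ≈ r
  fixed-component-≈ {u} {T} {S} hu {ρ} {r} hr {x} x∈T fixes =
    conclude (components-match {var 0} {λ _ → S x} {τ x} {σ x} Sx-separated here)
    where
    m : ℕ → Term (sig 𝕌) ℕ
    m y = trS (S y) ⟨ ρ ⟩
    τ : ℕ → Term (sig 𝕋) ℕ
    τ y = proj₁ (separation (m y))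
    σ : ℕ → ℕ → Term (sig 𝕊) ℕ
    σ y = proj₁ (proj₂ (separation (m y)))
    m≈sep : ∀ y → 𝕌 ⊢ m y ≈ sep cT cS (τ y) (σ y)
    m≈sep y = proj₂ (proj₂ (separation (m y)))

    merged : 𝕌 ⊢ sep cT cS (T ⟨ (λ y → τ y ⟨ (λ w → var (cantor y w)) ⟩) ⟩) (λ n → uncurry σ (uncantor n))
                ≈ sep cT cS (var 0) (λ _ → r)
    merged = begin
      _                                           ≈⟨ sep-merge T τ σ ⟩
      trT T ⟨ (λ y → sep cT cS (τ y) (σ y)) ⟩     ≈⟨ ⟨⟩-congʳ (trT T) (λ y _ → m≈sep y) ⟨
      trT T ⟨ m ⟩                                 ≈⟨ ⟨⟩-assoc (trT T) _ ρ ⟨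
      sep cT cS T S ⟨ ρ ⟩                         ≈⟨ ⟨⟩-congˡ ρ hu ⟨
      u ⟨ ρ ⟩                                     ≈⟨ hr ⟩
      trS r                                       ∎
      where open ≈-Reasoning 𝕌

    Sx-separated : 𝕌 ⊢ sep cT cS (var 0) (λ _ → S x) ≈ sep cT cS (τ x) (σ x)
    Sx-separated =
      ≈trans (≈sym (⟨⟩-fix (trS (S x)) λ v v∈ → fixes v (∈v-translate (inc cS) (S x) v∈))) (m≈sep x)

    conclude : (∃ λ w → w ∈v τ x × 𝕊 ⊢ S x ≈ σ x w) → 𝕊 ⊢ S x ≈ r
    conclude (w , w∈τx , Sx≈σxw) = begin
      S x                               ≈⟨ Sx≈σxw ⟩
      σ x w                             ≡⟨ cong (uncurry σ) (uncantor-cantor x w) ⟨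
      uncurry σ (uncantor (cantor x w)) ≈⟨ proj₂ (proj₂ (components-match {T' = var 0} {S' = λ _ → r}
                                                                           merged cantor-x-w∈)) ⟩
      r                                 ∎
      where
      open ≈-Reasoning 𝕊
      cantor-x-w∈ : cantor x w ∈v (T ⟨ (λ y → τ y ⟨ (λ w → var (cantor y w)) ⟩) ⟩)
      cantor-x-w∈ = ∈v-⟨⟩⁺ T x∈T (∈v-⟨⟩⁺ (τ x) w∈τx here)

  module _ (pgS : PreservesGround 𝕊) (hcS : HasConstant 𝕊) where

    component-vars : ∀ {u T S} → 𝕌 ⊢ u ≈ sep cT cS T S →
      ∀ {σ : ℕ → Term (sig 𝕊) ℕ} {a b c} → ¬ a ≡ b → b ∈v σ b →
      ∀ {ρ r} → FixesAllBut ρ b → 𝕌 ⊢ (u ⟨ ρ ⟩) ≈ trS r → VarsAre r a c →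
      ∀ {x} → x ∈v T → 𝕊 ⊢ (S x ⟨ σ ⟩) ≈ var a → VarsAre (S x) a c
    component-vars {S = S} hu {b = b} a≢b b∈σb ρ-fixes hr r-vars {x} x∈T Sxσ≈a =
      VarsAre-≈ pgS hcS (fixed-component-≈ hu hr x∈T λ v v∈ → ρ-fixes v λ { refl → b∉Sx v∈ }) r-vars
      where
      b∉Sx : ¬ b ∈v S x
      b∉Sx b∈ = a≢b (sym (∈v-var (∈v-≈ pgS hcS Sxσ≈a (∈v-⟨⟩⁺ (S x) b∈ b∈σb))))

    module _ {y₁ y₂ x₀ : ℕ} (y₁≢y₂ : ¬ y₁ ≡ y₂) (y₁≢x₀ : ¬ y₁ ≡ x₀) (y₂≢x₀ : ¬ y₂ ≡ x₀) where

      components-split : ∀ {u T S} → 𝕌 ⊢ u ≈ sep cT cS T S →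
        ∀ {σ P} → FixesAllBut σ x₀ → VarsAre P y₁ y₂ → 𝕌 ⊢ (u ⟨ (λ v → trS (σ v)) ⟩) ≈ trT P →
        ∀ {ρ₂ r₁} → FixesAllBut ρ₂ y₂ → 𝕌 ⊢ (u ⟨ ρ₂ ⟩) ≈ trS r₁ → VarsAre r₁ y₁ x₀ →
        ∀ {ρ₁ r₂} → FixesAllBut ρ₁ y₁ → 𝕌 ⊢ (u ⟨ ρ₁ ⟩) ≈ trS r₂ → VarsAre r₂ y₂ x₀ →
        ComponentsSplit T S y₁ y₂ x₀
      components-split {u} {T} {S} hu {σ} {P} σ-fixes P-vars huσ
                       ρ₂-fixes hr₁ r₁-vars ρ₁-fixes hr₂ r₂-vars =
        classify , exists (inj₁ refl) vars₁ , exists (inj₂ refl) vars₂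
        where
        separated : 𝕌 ⊢ sep cT cS T (λ x → S x ⟨ σ ⟩) ≈ sep cT cS P var
        separated = begin
          sep cT cS T (λ x → S x ⟨ σ ⟩)           ≈⟨ sep-⟨⟩ T S σ ⟨
          sep cT cS T S ⟨ (λ v → trS (σ v)) ⟩     ≈⟨ ⟨⟩-congˡ _ hu ⟨
          u ⟨ (λ v → trS (σ v)) ⟩                 ≈⟨ huσ ⟩
          trT P                                   ≈⟨ ⟨var⟩ (trT P) ⟨
          trT P ⟨ var ⟩                           ∎
          where open ≈-Reasoning 𝕌

        y∈σy : ∀ {y} → ¬ y ≡ x₀ → y ∈v σ y
        y∈σy {y} y≢x₀ = subst (y ∈v_) (sym (σ-fixes y y≢x₀)) here

        vars₁ : ∀ {x} → x ∈v T → 𝕊 ⊢ (S x ⟨ σ ⟩) ≈ var y₁ → VarsAre (S x) y₁ x₀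
        vars₁ = component-vars hu y₁≢y₂ (y∈σy y₂≢x₀) ρ₂-fixes hr₁ r₁-vars

        vars₂ : ∀ {x} → x ∈v T → 𝕊 ⊢ (S x ⟨ σ ⟩) ≈ var y₂ → VarsAre (S x) y₂ x₀
        vars₂ = component-vars hu (λ e → y₁≢y₂ (sym e)) (y∈σy y₁≢x₀) ρ₁-fixes hr₂ r₂-vars

        classify : ∀ x → x ∈v T → VarsAre (S x) y₁ x₀ ⊎ VarsAre (S x) y₂ x₀
        classify x x∈T with components-match {T' = P} {S' = var} separated x∈T
        ... | n , n∈P , Sxσ≈n with proj₁ (P-vars n) n∈P
        ...   | inj₁ refl = inj₁ (vars₁ x∈T Sxσ≈n)
        ...   | inj₂ refl = inj₂ (vars₂ x∈T Sxσ≈n)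

        exists : ∀ {y} → y ≡ y₁ ⊎ y ≡ y₂ →
                 (∀ {x} → x ∈v T → 𝕊 ⊢ (S x ⟨ σ ⟩) ≈ var y → VarsAre (S x) y x₀) →
                 ∃ λ x → x ∈v T × VarsAre (S x) y x₀
        exists y∈ vars
          with components-match {T' = T} {S' = λ x → S x ⟨ σ ⟩} (≈sym separated) (proj₂ (P-vars _) y∈)
        ... | x , x∈T , y≈Sxσ = x , x∈T , vars x∈T (≈sym y≈Sxσ)

      module Splitting (t : Term (sig 𝕋) (Fin 2)) (et : Op (sig 𝕋)) (et0 : arity (sig 𝕋) et ≡ 0)
        (tʳ : ∀ x → 𝕋 ⊢ (t ⟨ pair (var x) (const et et0) ⟩) ≈ var x)
        (tˡ : ∀ x → 𝕋 ⊢ (t ⟨ pair (const et et0) (var x) ⟩) ≈ var x) where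

        P : Term (sig 𝕋) ℕ
        P = t ⟨ pair (var y₁) (var y₂) ⟩

        private
          module UT = Unital pgT et et0 t tʳ tˡ

          erase : ℕ → ℕ → Term (sig 𝕌) ℕ
          erase z v = trT ((z ↦ const et et0) v)

          erase-fixesAllBut : ∀ z → FixesAllBut (erase z) z
          erase-fixesAllBut z v v≢z = cong trT (↦-fixesAllBut z _ v v≢z)

          P-⟨⟩ : ∀ θ → 𝕌 ⊢ (trT P ⟨ θ ⟩) ≈ (trT t ⟨ pair (θ y₁) (θ y₂) ⟩)
          P-⟨⟩ θ = ≈trans (⟨⟩-congˡ θ (translate-⟨pair⟩ cT t)) (⟨pair⟩-⟨⟩ (trT t) θ)

          P-erase₂ : 𝕌 ⊢ (trT P ⟨ erase y₂ ⟩) ≈ var y₁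
          P-erase₂ = begin
            trT P ⟨ erase y₂ ⟩                            ≈⟨ P-⟨⟩ (erase y₂) ⟩
            trT t ⟨ pair (erase y₂ y₁) (erase y₂ y₂) ⟩    ≈⟨ ⟨pair⟩-cong (trT t) (≡⇒≈ y₁-kept) (≡⇒≈ y₂-erased) ⟩
            trT t ⟨ pair (var y₁) (trT (const et et0)) ⟩  ≈⟨ UT.translate-identityʳ cT (var y₁) ⟩
            var y₁                                        ∎
            where
            open ≈-Reasoning 𝕌
            y₁-kept : erase y₂ y₁ ≡ var y₁
            y₁-kept = erase-fixesAllBut y₂ y₁ y₁≢y₂
            y₂-erased : erase y₂ y₂ ≡ trT (const et et0)
            y₂-erased = cong trT (↦-self y₂ _)

          P-erase₁ : 𝕌 ⊢ (trT P ⟨ erase y₁ ⟩) ≈ var y₂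
          P-erase₁ = begin
            trT P ⟨ erase y₁ ⟩                            ≈⟨ P-⟨⟩ (erase y₁) ⟩
            trT t ⟨ pair (erase y₁ y₁) (erase y₁ y₂) ⟩    ≈⟨ ⟨pair⟩-cong (trT t) (≡⇒≈ y₁-erased) (≡⇒≈ y₂-kept) ⟩
            trT t ⟨ pair (trT (const et et0)) (var y₂) ⟩  ≈⟨ UT.translate-identityˡ cT (var y₂) ⟩
            var y₂                                        ∎
            where
            open ≈-Reasoning 𝕌
            y₁-erased : erase y₁ y₁ ≡ trT (const et et0)
            y₁-erased = cong trT (↦-self y₁ _)
            y₂-kept : erase y₁ y₂ ≡ var y₂
            y₂-kept = erase-fixesAllBut y₁ y₂ λ e → y₁≢y₂ (sym e)

        SplitSeparation : Term (sig 𝕌) ℕ → Set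
        SplitSeparation u = Σ (Term (sig 𝕋) ℕ) λ T → Σ (ℕ → Term (sig 𝕊) ℕ) λ S →
                              (𝕌 ⊢ u ≈ sep cT cS T S) × ComponentsSplit T S y₁ y₂ x₀

        SplitSeparation-≈ : ∀ {u u'} → 𝕌 ⊢ u ≈ u' → SplitSeparation u' → SplitSeparation u
        SplitSeparation-≈ u≈u' (T , S , hu' , split) = T , S , ≈trans u≈u' hu' , split

        left-split : (e : Op (sig 𝕊)) (e0 : arity (sig 𝕊) e ≡ 0) (b : Term (sig 𝕊) (Fin 2)) →
          (∀ x → 𝕊 ⊢ (b ⟨ pair (var x) (const e e0) ⟩) ≈ var x) →
          (∀ x → 𝕊 ⊢ (b ⟨ pair (const e e0) (var x) ⟩) ≈ var x) →
          SplitSeparation (trS b ⟨ pair (trT P) (var x₀) ⟩)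
        left-split e e0 b bʳ bˡ =
          T , S , hu ,
          components-split hu (↦-fixesAllBut x₀ E) (UT.VarsAre-⟨pair⟩ y₁ y₂) u-σ
            (erase-fixesAllBut y₂) (u-erase (λ e → y₂≢x₀ (sym e)) P-erase₂) (UB.VarsAre-⟨pair⟩ y₁ x₀)
            (erase-fixesAllBut y₁) (u-erase (λ e → y₁≢x₀ (sym e)) P-erase₁) (UB.VarsAre-⟨pair⟩ y₂ x₀)
          where
          module UB = Unital pgS e e0 b bʳ bˡ
          open ≈-Reasoning 𝕌

          E : Term (sig 𝕊) ℕ
          E = const e e0

          u : Term (sig 𝕌) ℕ
          u = trS b ⟨ pair (trT P) (var x₀) ⟩

          T : Term (sig 𝕋) ℕ
          T = proj₁ (separation u)
          S : ℕ → Term (sig 𝕊) ℕ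
          S = proj₁ (proj₂ (separation u))
          hu : 𝕌 ⊢ u ≈ sep cT cS T S
          hu = proj₂ (proj₂ (separation u))

          u-σ : 𝕌 ⊢ (u ⟨ (λ v → trS ((x₀ ↦ E) v)) ⟩) ≈ trT P
          u-σ = begin
            u ⟨ θ ⟩                                  ≈⟨ ⟨pair⟩-⟨⟩ (trS b) θ ⟩
            trS b ⟨ pair (trT P ⟨ θ ⟩) (θ x₀) ⟩      ≈⟨ ⟨pair⟩-cong (trS b) (⟨⟩-fix (trT P) θ-fixes-P)
                                                                           (≡⇒≈ (cong trS (↦-self x₀ E))) ⟩
            trS b ⟨ pair (trT P) (trS E) ⟩           ≈⟨ UB.translate-identityʳ cS (trT P) ⟩
            trT P                                    ∎
            where
            θ : ℕ → Term (sig 𝕌) ℕ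
            θ v = trS ((x₀ ↦ E) v)
            θ-fixes-P : ∀ v → v ∈v trT P → θ v ≡ var v
            θ-fixes-P v v∈ with proj₁ (UT.VarsAre-⟨pair⟩ y₁ y₂ v) (∈v-translate (inc cT) P v∈)
            ... | inj₁ refl = cong trS (↦-fixesAllBut x₀ E v y₁≢x₀)
            ... | inj₂ refl = cong trS (↦-fixesAllBut x₀ E v y₂≢x₀)

          u-erase : ∀ {z y} → ¬ x₀ ≡ z → 𝕌 ⊢ (trT P ⟨ erase z ⟩) ≈ var y →
                    𝕌 ⊢ (u ⟨ erase z ⟩) ≈ trS (b ⟨ pair (var y) (var x₀) ⟩)
          u-erase {z} {y} x₀≢z P-erased = begin
            u ⟨ erase z ⟩                                     ≈⟨ ⟨pair⟩-⟨⟩ (trS b) (erase z) ⟩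
            trS b ⟨ pair (trT P ⟨ erase z ⟩) (erase z x₀) ⟩   ≈⟨ ⟨pair⟩-cong (trS b) P-erased
                                                                   (≡⇒≈ (erase-fixesAllBut z x₀ x₀≢z)) ⟩
            trS b ⟨ pair (var y) (var x₀) ⟩                   ≈⟨ translate-⟨pair⟩ cS b ⟨
            trS (b ⟨ pair (var y) (var x₀) ⟩)                 ∎

        right-split : (e : Op (sig 𝕊)) (e0 : arity (sig 𝕊) e ≡ 0) (b : Term (sig 𝕊) (Fin 2)) →
          (∀ x → 𝕊 ⊢ (b ⟨ pair (var x) (const e e0) ⟩) ≈ var x) →
          (∀ x → 𝕊 ⊢ (b ⟨ pair (const e e0) (var x) ⟩) ≈ var x) →
          SplitSeparation (trS b ⟨ pair (var x₀) (trT P) ⟩)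
        right-split e e0 b bʳ bˡ =
          SplitSeparation-≈ flipped
            (left-split e e0 (flip b) (λ x → ≈trans (flip-⟨pair⟩ b) (bˡ x))
                                      (λ x → ≈trans (flip-⟨pair⟩ b) (bʳ x)))
          where
          flipped : 𝕌 ⊢ (trS b ⟨ pair (var x₀) (trT P) ⟩) ≈ (trS (flip b) ⟨ pair (trT P) (var x₀) ⟩)
          flipped = ≈sym (translate-flip-⟨pair⟩ cS b)

lemma4p11 : (𝕊 𝕋 : Theory) →
    PreservesGround 𝕊 → VarCondition 𝕊 → S4 𝕊 → PreservesGround 𝕋 → HasConstant 𝕋 →
    (s : Term (sig 𝕊) (Fin 2)) (t : Term (sig 𝕋) (Fin 2)) →
    (es : Op (sig 𝕊)) (es0 : arity (sig 𝕊) es ≡ 0) →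
    (et : Op (sig 𝕋)) (et0 : arity (sig 𝕋) et ≡ 0) →
    (∀ (x : ℕ) → 𝕊 ⊢ (s ⟨ pair (var x) (const es es0) ⟩) ≈ var x) →
    (∀ (x : ℕ) → 𝕊 ⊢ (s ⟨ pair (const es es0) (var x) ⟩) ≈ var x) →
    (∀ (x : ℕ) → 𝕋 ⊢ (t ⟨ pair (var x) (const et et0) ⟩) ≈ var x) →
    (∀ (x : ℕ) → 𝕋 ⊢ (t ⟨ pair (const et et0) (var x) ⟩) ≈ var x) →
    (𝕌 : Theory) (cT : Contains 𝕌 𝕋) (cS : Contains 𝕌 𝕊) → IsComposite 𝕌 𝕋 𝕊 cT cS →
    (y₁ y₂ x₀ : ℕ) → ¬ (y₁ ≡ y₂) → ¬ (y₁ ≡ x₀) → ¬ (y₂ ≡ x₀) →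
    (Σ (Term (sig 𝕋) ℕ) λ t' → Σ (ℕ → Term (sig 𝕊) ℕ) λ s' →
       (𝕌 ⊢ (translate (inc cS) s ⟨ pair (translate (inc cT) (t ⟨ pair (var y₁) (var y₂) ⟩)) (var x₀) ⟩)
          ≈ sep cT cS t' s')
       × (∀ x → x ∈v t' → VarsAre (s' x) y₁ x₀ ⊎ VarsAre (s' x) y₂ x₀)
       × (∃ λ x → x ∈v t' × VarsAre (s' x) y₁ x₀)
       × (∃ λ x → x ∈v t' × VarsAre (s' x) y₂ x₀))
    ×
    (Σ (Term (sig 𝕋) ℕ) λ t'' → Σ (ℕ → Term (sig 𝕊) ℕ) λ s'' →
       (𝕌 ⊢ (translate (inc cS) s ⟨ pair (var x₀) (translate (inc cT) (t ⟨ pair (var y₁) (var y₂) ⟩)) ⟩)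
          ≈ sep cT cS t'' s'')
       × (∀ x → x ∈v t'' → VarsAre (s'' x) y₁ x₀ ⊎ VarsAre (s'' x) y₂ x₀)
       × (∃ λ x → x ∈v t'' × VarsAre (s'' x) y₁ x₀)
       × (∃ λ x → x ∈v t'' × VarsAre (s'' x) y₂ x₀))
lemma4p11 𝕊 𝕋 pgS _ _ pgT hcT s t es es0 et et0 sʳ sˡ tʳ tˡ 𝕌 cT cS composite
          y₁ y₂ x₀ y₁≢y₂ y₁≢x₀ y₂≢x₀ =
  left-split es es0 s sʳ sˡ , right-split es es0 s sʳ sˡ
  where
  open Composite composite pgT hcT
  open Splitting pgS (es , es0) y₁≢y₂ y₁≢x₀ y₂≢x₀ t et et0 tʳ tˡ
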